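{- Let $G_3$ be the following graph: a $5$-cycle $C_2=v_1u_2v_3u_4u_5$ (edges $v_1u_2,u_2v_3,v_3u_4,u_4u_5,u_5v_1$), a vertex $y_1$ adjacent to all five vertices of $C_2$, a triangle $y_2y_3y_4$, the edge $y_1y_2$, and for each $i\in\{1,2\}$ vertices $z_{i,1},\dots,z_{i,7}$ with edges $y_4z_{i,1}$, $y_4z_{i,2}$, $z_{i,j}z_{i,k}$ for all $1\le j<k\le 4$ with $(j,k)\ne(1,2)$, the triangle $z_{i,5}z_{i,6}z_{i,7}$, and the edge $z_{i,4}z_{i,5}$. Let $G_4$ be obtained from $G_3$ by adding new vertices forming three triangles $w_1w_2w_3$, $w_{1,1}w_{1,2}w_{1,3}$, $w_{2,1}w_{2,2}w_{2,3}$, and the edges $z_{1,7}w_1$, $z_{2,7}w_1$, $w_3w_{1,1}$, $w_3w_{2,1}$. Define $L_4$ by $L_4(v)=\{1,\dots,6\}$ for $v\in V(C_2)$, $L_4(y_1)=\{1,\dots,8\}$, $L_4(y_2)=L_4(y_4)=\{1,2,3,4,7,8\}$, $L_4(y_3)=\{1,2,3,4\}$; for $i\in\{1,2\}$: $L_4(z_{i,1})=\{1,2,3,6+i\}$, $L_4(z_{i,2})=\{4,5,6,6+i\}$, $L_4(z_{i,3})=\{1,\dots,6\}$, $L_4(z_{i,4})=\{1,\dots,8\}$, $L_4(z_{i,5})=L_4(z_{i,7})=\{1,2,3,4,7,8\}$, $L_4(z_{i,6})=\{1,2,3,4\}$; and $L_4(w_1)=L_4(w_3)=L_4(w_{i,1})=L_4(w_{i,3})=\{1,2,3,4,7,8\}$,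 $L_4(w_2)=L_4(w_{i,2})=\{1,2,3,4\}$ for $i\in\{1,2\}$. Then the gadget $(G_4,L_4)$ is $(v_1,v_3,\{w_{1,3},w_{2,3}\})$-relaxed, and every $(L_4:2)$-coloring $\varphi$ of $G_4$ satisfies $\varphi(w_{1,3})=\varphi(w_{2,3})=\{7,8\}$.
   Context: A list assignment $L$ for a graph $G$ assigns to each vertex $v$ a set $L(v)$ of colors. An $L$-coloring of $G$ is a proper vertex coloring $c$ with $c(v)\in L(v)$ for all $v$. For $S\subseteq V(G)$, an $L$-coloring of $S$ is an $L$-coloring of the induced subgraph $G[S]$; if $S\subseteq S'$ and $\varphi'$ is an $L$-coloring of $S'$, then $\varphi'$ extends an $L$-coloring $\varphi$ of $S$ if $\varphi'|_S=\varphi$. An $(L:2)$-coloring assigns to each vertex $v$ a $2$-element subset $\varphi(v)\subseteq L(v)$ such that adjacent vertices receive disjoint sets. A gadget is a pair $(G,L_0)$ where $L_0$ is a list assignment with all lists of even size; a half-list assignment for $(G,L_0)$ is any list assignment $L$ with $|L(v)|=|L_0(v)|/2$ for all $v$. For distinct vertices $v_1,v_3$ and a set $S\subseteq V(G)\setminus\{v_1,v_3\}$, the gadget is $(v_1,v_3,S)$-relaxed if every half-list assignment $L$ satisfies at least one of: (i) there is an $L$-coloring $\psi_0$ of $\{v_1,v_3\}$ such that every $L$-coloring of $S\cup\{v_1,v_3\}$ extending $\psi_0$ extends to an $L$-coloring of $G$; (ii) $L(v_1)=L(v_3)$ and there is an $L$-coloring $\psi_0$ of $S$ such that every $L$-coloring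 of $S\cup\{v_1,v_3\}$ extending $\psi_0$ extends to an $L$-coloring of $G$. -}

module Defs where

open import Data.Nat using (ℕ)
open import Data.Nat.Base using (_*_)
open import Data.List using (List; []; _∷_; _++_; length)
open import Data.List.Membership.Propositional using (_∈_)
open import Data.List.Relation.Unary.Unique.Propositional using (Unique)
import Data.Product
open import Data.Product using (Σ; _×_; _,_; ∃)
open import Data.Sum using (_⊎_)
open import Data.Empty using (⊥)
open import Relation.Nullary using (¬_)
open import Relation.Binary.PropositionalEquality using (_≡_; _≢_)
open import Function.Bundles using (_⇔_)

data I : Set where
  i1 i2 : I

data J7 : Set where
  j1 j2 j3 j4 j5 j6 j7 : J7

data J3 : Set where
  k1 k2 k3 : J3

-- vertices of G₄
--   z i j  = z_{i,j},   w' i k = w_{i,k}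
data V : Set where
  v1 u2 v3 u4 u5 : V
  y1 y2 y3 y4 : V
  z : I → J7 → V
  w1 w2 w3 : V
  w' : I → J3 → V

edgesᵢ : I → List (V × V)
edgesᵢ i =
  (y4 , z i j1) ∷ (y4 , z i j2) ∷
  (z i j1 , z i j3) ∷ (z i j1 , z i j4) ∷ (z i j2 , z i j3) ∷
  (z i j2 , z i j4) ∷ (z i j3 , z i j4) ∷
  (z i j5 , z i j6) ∷ (z i j6 , z i j7) ∷ (z i j5 , z i j7) ∷
  (z i j4 , z i j5) ∷
  (w' i k1 , w' i k2) ∷ (w' i k2 , w' i k3) ∷ (w' i k1 , w' i k3) ∷
  (z i j7 , w1) ∷ (w3 , w' i k1) ∷ []

-- all edges of G₄ (unordered; listed once each)
edges : List (V × V)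
edges =
  (v1 , u2) ∷ (u2 , v3) ∷ (v3 , u4) ∷ (u4 , u5) ∷ (u5 , v1) ∷
  (y1 , v1) ∷ (y1 , u2) ∷ (y1 , v3) ∷ (y1 , u4) ∷ (y1 , u5) ∷
  (y2 , y3) ∷ (y3 , y4) ∷ (y2 , y4) ∷ (y1 , y2) ∷
  (w1 , w2) ∷ (w2 , w3) ∷ (w1 , w3) ∷
  (edgesᵢ i1 ++ edgesᵢ i2)

Adj : V → V → Set
Adj u v = ((u , v) ∈ edges) ⊎ ((v , u) ∈ edges)

sixPlus : I → ℕ
sixPlus i1 = 7
sixPlus i2 = 8

L4 : V → List ℕ
L4 v1 = 1 ∷ 2 ∷ 3 ∷ 4 ∷ 5 ∷ 6 ∷ []
L4 u2 = 1 ∷ 2 ∷ 3 ∷ 4 ∷ 5 ∷ 6 ∷ []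
L4 v3 = 1 ∷ 2 ∷ 3 ∷ 4 ∷ 5 ∷ 6 ∷ []
L4 u4 = 1 ∷ 2 ∷ 3 ∷ 4 ∷ 5 ∷ 6 ∷ []
L4 u5 = 1 ∷ 2 ∷ 3 ∷ 4 ∷ 5 ∷ 6 ∷ []
L4 y1 = 1 ∷ 2 ∷ 3 ∷ 4 ∷ 5 ∷ 6 ∷ 7 ∷ 8 ∷ []
L4 y2 = 1 ∷ 2 ∷ 3 ∷ 4 ∷ 7 ∷ 8 ∷ []
L4 y3 = 1 ∷ 2 ∷ 3 ∷ 4 ∷ []
L4 y4 = 1 ∷ 2 ∷ 3 ∷ 4 ∷ 7 ∷ 8 ∷ []
L4 (z i j1) = 1 ∷ 2 ∷ 3 ∷ sixPlus i ∷ []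
L4 (z i j2) = 4 ∷ 5 ∷ 6 ∷ sixPlus i ∷ []
L4 (z i j3) = 1 ∷ 2 ∷ 3 ∷ 4 ∷ 5 ∷ 6 ∷ []
L4 (z i j4) = 1 ∷ 2 ∷ 3 ∷ 4 ∷ 5 ∷ 6 ∷ 7 ∷ 8 ∷ []
L4 (z i j5) = 1 ∷ 2 ∷ 3 ∷ 4 ∷ 7 ∷ 8 ∷ []
L4 (z i j6) = 1 ∷ 2 ∷ 3 ∷ 4 ∷ []
L4 (z i j7) = 1 ∷ 2 ∷ 3 ∷ 4 ∷ 7 ∷ 8 ∷ []
L4 w1 = 1 ∷ 2 ∷ 3 ∷ 4 ∷ 7 ∷ 8 ∷ []
L4 w2 = 1 ∷ 2 ∷ 3 ∷ 4 ∷ []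
L4 w3 = 1 ∷ 2 ∷ 3 ∷ 4 ∷ 7 ∷ 8 ∷ []
L4 (w' i k1) = 1 ∷ 2 ∷ 3 ∷ 4 ∷ 7 ∷ 8 ∷ []
L4 (w' i k2) = 1 ∷ 2 ∷ 3 ∷ 4 ∷ []
L4 (w' i k3) = 1 ∷ 2 ∷ 3 ∷ 4 ∷ 7 ∷ 8 ∷ []

-- list assignments: each vertex gets a finite list (read as a set) of colors
ListAssignment : Set
ListAssignment = V → List ℕ

IsHalfList : ListAssignment → Set
IsHalfList L = ∀ v → Unique (L v) × (length (L v) * 2 ≡ length (L4 v))

Subset : Set₁
Subset = V → Set

_∪_ : Subset → Subset → Subset
(S ∪ T) v = S v ⊎ T v

Whole : Subset
Whole _ = V

Pair : V → V → Subset
Pair a b v = (v ≡ a) ⊎ (v ≡ b)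

-- φ restricted to S is an L-coloring of G₄[S]
-- (values of φ outside S are irrelevant)
IsLColoringOn : ListAssignment → Subset → (V → ℕ) → Set
IsLColoringOn L S φ =
  (∀ v → S v → φ v ∈ L v) ×
  (∀ u v → S u → S v → Adj u v → φ u ≢ φ v)

AgreeOn : Subset → (V → ℕ) → (V → ℕ) → Set
AgreeOn S φ ψ = ∀ v → S v → φ v ≡ ψ v

ExtendsAll : ListAssignment → Subset → Subset → (V → ℕ) → Set
ExtendsAll L A ST ψ0 =
  ∀ φ → IsLColoringOn L ST φ → AgreeOn A ψ0 φ →
    ∃ λ φ' → IsLColoringOn L Whole φ' × AgreeOn ST φ φ'

Relaxed : V → V → Subset → Set
Relaxed a b S =
  ∀ (L : ListAssignment) → IsHalfList L →
    (∃ λ ψ0 → IsLColoringOn L (Pair a b) ψ0 ×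
              ExtendsAll L (Pair a b) (S ∪ Pair a b) ψ0)
    ⊎
    ((∀ c → (c ∈ L a) ⇔ (c ∈ L b)) ×
     (∃ λ ψ0 → IsLColoringOn L S ψ0 ×
              ExtendsAll L S (S ∪ Pair a b) ψ0))

-- an (L₄:2)-coloring: each vertex gets a 2-element subset {fst, snd}
-- (fst ≢ snd) of L₄(v), adjacent vertices get disjoint sets
Is2Coloring : (V → ℕ × ℕ) → Set
Is2Coloring φ =
  (∀ v → Data.Product.proj₁ (φ v) ≢ Data.Product.proj₂ (φ v)) ×
  (∀ v → Data.Product.proj₁ (φ v) ∈ L4 v × Data.Product.proj₂ (φ v) ∈ L4 v) ×
  (∀ u v → Adj u v → ∀ c →
     (c ≡ Data.Product.proj₁ (φ u) ⊎ c ≡ Data.Product.proj₂ (φ u)) →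
     (c ≡ Data.Product.proj₁ (φ v) ⊎ c ≡ Data.Product.proj₂ (φ v)) → ⊥)

Is78 : ℕ × ℕ → Set
Is78 (a , b) = (a ≡ 7 × b ≡ 8) ⊎ (a ≡ 8 × b ≡ 7)

-- Relaxedness: the wheel around v₁, v₃ either admits a precolouring of v₁, v₃ with two usable
-- hub colours, or forces L(v₁) = L(v₃) and extends every precolouring. In the first case the rest
-- of G₄ is coloured from w_{i,3} backwards: each K₄ − e gadget z_{i,1..4} blocks at most one
-- colour of y₄, and the spare hub colour avoids y₂. In the second case w_{i,3} is precoloured
-- outside L(w_{i,2}) and everything is coloured greedily outwards from the wheel.
--
-- The (L₄:2) part: the 5-wheel cannot be 2-fold coloured from {1,…,6} around a hub in {1,…,6},
-- so y₁, and with it y₄, takes 7 or 8, say 6+i. This pushes z_{i,4} onto {7,8}, and each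
-- subsequent triangle (z_{i,5..7}, w₁..₃, w_{j,1..3}) with lists over {1,2,3,4,7,8} and middle
-- list {1,2,3,4} passes {7,8} on to its last corner.
module Submission where

open import Data.Bool using (Bool; true; false; T)
open import Data.Unit using (tt)
open import Data.Empty using (⊥; ⊥-elim)
open import Data.Fin using (Fin; #_)
open import Data.List using (List; []; _∷_; _++_; length; filter; lookup; take)
open import Data.List.Membership.Propositional using (_∈_; _∉_)
open import Data.List.Membership.Propositional.Properties using (∈-++⁺ˡ; ∈-++⁺ʳ; ∈-++⁻; ∈-filter⁺; ∈-lookup)
open import Data.List.Properties using (filter-notAll)
open import Data.List.Relation.Binary.Disjoint.Propositional using (Disjoint)
open import Data.List.Relation.Unary.All as All using (All; []; _∷_)
open import Data.List.Relation.Unary.All.Properties using (¬Any⇒All¬) renaming (++⁺ to All-++⁺)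
open import Data.List.Relation.Unary.Any as Any using (Any; here; there)
open import Data.List.Relation.Unary.Unique.Propositional using (Unique; []; _∷_)
open import Data.List.Relation.Unary.Unique.Propositional.Properties using () renaming (++⁺ to Unique-++⁺)
open import Data.Nat using (ℕ; suc; _≤_; _<_; _<?_; z≤n; s≤s; _/_; _≟_)
open import Data.List.Membership.DecPropositional _≟_ using (_∈?_)
open import Data.List.Relation.Binary.Subset.DecPropositional _≟_ using (_⊆?_)
open import Data.List.Relation.Binary.Subset.Propositional using (_⊆_)
open import Data.Nat.DivMod using (m*n/n≡m)
open import Data.Nat.Properties using (<⇒≱; ≤-refl; n≮n; module ≤-Reasoning)
open import Data.Product using (_×_; _,_; ∃; proj₁; proj₂)
open import Data.Sum as Sum using (_⊎_; inj₁; inj₂; [_,_]′)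
open import Function using (_∘_; id)
open import Function.Bundles using (_⇔_; mk⇔)
open import Relation.Binary.PropositionalEquality using (_≡_; _≢_; refl; sym; trans; subst; subst₂; cong)
open import Relation.Nullary using (¬_; Dec; yes; no; ¬?; _×-dec_)
open import Relation.Nullary.Decidable using (True; toWitness; toSum; from-yes; T?; map′)

open import Defs

variable
  x y : ℕ
  xs ys zs : List ℕ

exists-or-forall : {A : Set} {P Q : A → Set} → (∀ a → P a ⊎ Q a) → (as : List A) →
                   (∃ λ a → a ∈ as × P a) ⊎ (∀ {a} → a ∈ as → Q a)
exists-or-forall decide [] = inj₂ λ ()
exists-or-forall decide (a ∷ as) with decide a | exists-or-forall decide as
... | inj₁ pa | _                  = inj₁ (a , here refl , pa)
... | inj₂ qa | inj₁ (b , b∈ , pb) = inj₁ (b , there b∈ , pb)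
... | inj₂ qa | inj₂ q             = inj₂ λ { (here refl) → qa ; (there a∈) → q a∈ }

⊈-witness-or-⊆ : ∀ xs ys → (∃ λ x → x ∈ xs × x ∉ ys) ⊎ xs ⊆ ys
⊈-witness-or-⊆ xs ys = exists-or-forall (λ x → Sum.swap (toSum (x ∈? ys))) xs

∉⇒≢ : x ∉ xs → y ∈ xs → x ≢ y
∉⇒≢ x∉ y∈ refl = x∉ y∈

∉⇒≢₀ : ∀ {a} → x ∉ a ∷ xs → x ≢ a
∉⇒≢₀ x∉ = ∉⇒≢ x∉ (here refl)

∉⇒≢₁ : ∀ {a b} → x ∉ a ∷ b ∷ xs → x ≢ b
∉⇒≢₁ x∉ = ∉⇒≢ x∉ (there (here refl))

∉⇒≢₂ : ∀ {a b c} → x ∉ a ∷ b ∷ c ∷ xs → x ≢ c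
∉⇒≢₂ x∉ = ∉⇒≢ x∉ (there (there (here refl)))

≢-sym : x ≢ y → y ≢ x
≢-sym x≢y = x≢y ∘ sym

∉-∷⁺ : ∀ {a} → x ≢ a → x ∉ xs → x ∉ a ∷ xs
∉-∷⁺ x≢a x∉ (here x≡a) = x≢a x≡a
∉-∷⁺ x≢a x∉ (there x∈) = x∉ x∈

Unique-∷⁺ : x ∉ xs → Unique xs → Unique (x ∷ xs)
Unique-∷⁺ {xs = xs} x∉ u = ¬Any⇒All¬ xs x∉ ∷ u

pair-unique : x ≢ y → Unique (x ∷ y ∷ [])
pair-unique x≢y = (x≢y ∷ []) ∷ [] ∷ []

Unique∧⊆⇒length≤ : Unique xs → xs ⊆ ys → length xs ≤ length ys
Unique∧⊆⇒length≤ {[]} _ _ = z≤n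
Unique∧⊆⇒length≤ {x ∷ xs} {ys} (x∉xs ∷ u) x∷xs⊆ys = begin
  suc (length xs)                    ≤⟨ s≤s (Unique∧⊆⇒length≤ u xs⊆ys∖x) ⟩
  suc (length (filter (¬? ∘ (x ≟_)) ys)) ≤⟨ filter-notAll (¬? ∘ (x ≟_)) ys x∈ys ⟩
  length ys                          ∎
  where
  open ≤-Reasoning
  xs⊆ys∖x : xs ⊆ filter (¬? ∘ (x ≟_)) ys
  xs⊆ys∖x y∈ = ∈-filter⁺ (¬? ∘ (x ≟_)) (x∷xs⊆ys (there y∈)) λ x≡y → All.lookup x∉xs y∈ x≡y
  x∈ys : Any (λ y → ¬ ¬ (x ≡ y)) ys
  x∈ys = Any.map (λ x≡y ¬x≡y → ¬x≡y x≡y) (x∷xs⊆ys (here refl))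

pigeonhole : ∀ {m n} → Unique xs → xs ⊆ ys → length xs ≡ m → length ys ≡ n → {True (n <? m)} → ⊥
pigeonhole u xs⊆ys refl refl {n<m} = <⇒≱ (toWitness n<m) (Unique∧⊆⇒length≤ u xs⊆ys)

Unique∧⊆∧length≡⇒⊇ : Unique xs → xs ⊆ ys → length ys ≡ length xs → ys ⊆ xs
Unique∧⊆∧length≡⇒⊇ {xs} {ys} u xs⊆ys ∣ys∣≡∣xs∣ {y} y∈ys with y ∈? xs
... | yes y∈xs = y∈xs
... | no  y∉xs = ⊥-elim (n≮n (length xs) (subst (length xs <_) ∣ys∣≡∣xs∣
                                                  (Unique∧⊆⇒length≤ (Unique-∷⁺ y∉xs u) y∷xs⊆ys)))
  where
  y∷xs⊆ys : y ∷ xs ⊆ ys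
  y∷xs⊆ys (here refl) = y∈ys
  y∷xs⊆ys (there x∈)  = xs⊆ys x∈

⊆-∷-both : x ≢ y → xs ⊆ x ∷ ys → xs ⊆ y ∷ ys → xs ⊆ ys
⊆-∷-both x≢y ⊆x∷ ⊆y∷ z∈ with ⊆x∷ z∈ | ⊆y∷ z∈
... | there z∈ys | _          = z∈ys
... | _          | there z∈ys = z∈ys
... | here refl  | here refl  = ⊥-elim (x≢y refl)

∈-snoc⁻ : x ∈ xs ++ y ∷ [] → x ∈ xs ⊎ x ≡ y
∈-snoc⁻ {xs = xs} x∈ with ∈-++⁻ xs x∈
... | inj₁ x∈xs       = inj₁ x∈xs
... | inj₂ (here x≡y) = inj₂ x≡y

⊆-++-Disjointˡ : xs ⊆ ys ++ zs → Disjoint xs ys → xs ⊆ zs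
⊆-++-Disjointˡ {ys = ys} xs⊆ xs#ys x∈ with ∈-++⁻ ys (xs⊆ x∈)
... | inj₁ x∈ys = ⊥-elim (xs#ys (x∈ , x∈ys))
... | inj₂ x∈zs = x∈zs

⊆-++-Disjointʳ : xs ⊆ ys ++ zs → Disjoint xs zs → xs ⊆ ys
⊆-++-Disjointʳ {ys = ys} xs⊆ xs#zs x∈ with ∈-++⁻ ys (xs⊆ x∈)
... | inj₁ x∈ys = x∈ys
... | inj₂ x∈zs = ⊥-elim (xs#zs (x∈ , x∈zs))

Disjoint-++ : Disjoint xs ys → Disjoint xs zs → Disjoint xs (ys ++ zs)
Disjoint-++ {ys = ys} xs#ys xs#zs (x∈xs , x∈ys++zs) =
  [ (λ x∈ys → xs#ys (x∈xs , x∈ys)) , (λ x∈zs → xs#zs (x∈xs , x∈zs)) ]′ (∈-++⁻ ys x∈ys++zs)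

Disjoint? : ∀ xs ys → Dec (Disjoint xs ys)
Disjoint? xs ys = map′ (λ xs∌ (x∈xs , x∈ys) → All.lookup xs∌ x∈xs x∈ys)
                       (λ xs#ys → All.tabulate λ x∈xs x∈ys → xs#ys (x∈xs , x∈ys))
                       (All.all? (λ x → ¬? (x ∈? ys)) xs)

_∖_ : List ℕ → List ℕ → List ℕ
xs ∖ ys = filter (λ x → ¬? (x ∈? ys)) xs

∈-∖⁺ : x ∈ xs → x ∉ ys → x ∈ xs ∖ ys
∈-∖⁺ {ys = ys} = ∈-filter⁺ (λ x → ¬? (x ∈? ys))

all-but-one : {Good Bad : ℕ → Set} → (∀ t → Good t ⊎ Bad t) →
              (∀ {t t′} → Bad t → Bad t′ → t ≡ t′) →
              ∀ xs → (∀ {t} → Bad t → t ∈ xs) →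
              ∃ λ d → ∀ t → t ≢ d → Good t
all-but-one decide bad-unique xs bad∈xs with exists-or-forall (Sum.swap ∘ decide) xs
... | inj₁ (d , _ , bad-d) = d , λ t t≢d → [ id , (λ bad-t → ⊥-elim (t≢d (bad-unique bad-t bad-d))) ]′ (decide t)
... | inj₂ good-on-xs      = 0 , λ t _ → [ id , (λ bad-t → good-on-xs (bad∈xs bad-t)) ]′ (decide t)

record Avoiding (xs ys : List ℕ) : Set where
  constructor avoiding
  field
    colour  : ℕ
    allowed : colour ∈ xs
    avoids  : colour ∉ ys

avoiding-< : Unique xs → length ys < length xs → Avoiding xs ys
avoiding-< {xs} {ys} u ∣ys∣<∣xs∣ with ⊈-witness-or-⊆ xs ys
... | inj₁ (x , x∈xs , x∉ys) = avoiding x x∈xs x∉ys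
... | inj₂ xs⊆ys             = ⊥-elim (<⇒≱ ∣ys∣<∣xs∣ (Unique∧⊆⇒length≤ u xs⊆ys))

fresh : ∀ {n} → Unique xs → length xs ≡ n → ∀ ys → {True (length ys <? n)} → Avoiding xs ys
fresh u refl ys {∣ys∣<n} = avoiding-< u (toWitness ∣ys∣<n)

-- The diamond K₄ − z₁z₂ on z₁ z₂ z₃ z₄: t is the colour of a common outside
-- neighbour of z₁ and z₂, f that of an outside neighbour of z₄.
record DiamondColouring (A₁ A₂ A₃ A₄ : List ℕ) (f t : ℕ) : Set where
  constructor diamond
  field
    c₁ c₂ c₃ c₄ : ℕ
    c₁∈ : c₁ ∈ A₁
    c₂∈ : c₂ ∈ A₂
    c₃∈ : c₃ ∈ A₃
    c₄∈ : c₄ ∈ A₄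
    c₁≢t : c₁ ≢ t
    c₂≢t : c₂ ≢ t
    c₁≢c₃ : c₁ ≢ c₃
    c₁≢c₄ : c₁ ≢ c₄
    c₂≢c₃ : c₂ ≢ c₃
    c₂≢c₄ : c₂ ≢ c₄
    c₃≢c₄ : c₃ ≢ c₄
    c₄≢f : c₄ ≢ f

DiamondColouring-swap : ∀ {A₁ A₂ A₃ A₄ f t} →
                        DiamondColouring A₁ A₂ A₃ A₄ f t → DiamondColouring A₂ A₁ A₃ A₄ f t
DiamondColouring-swap (diamond c₁ c₂ c₃ c₄ c₁∈ c₂∈ c₃∈ c₄∈ c₁≢t c₂≢t c₁≢c₃ c₁≢c₄ c₂≢c₃ c₂≢c₄ c₃≢c₄ c₄≢f) =
  diamond c₂ c₁ c₃ c₄ c₂∈ c₁∈ c₃∈ c₄∈ c₂≢t c₁≢t c₂≢c₃ c₂≢c₄ c₁≢c₃ c₁≢c₄ c₃≢c₄ c₄≢f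

module Diamond {A₃ A₄ : List ℕ} (u₃ : Unique A₃) (u₄ : Unique A₄)
               (∣A₃∣ : length A₃ ≡ 3) (∣A₄∣ : length A₄ ≡ 4) (f : ℕ) where

  -- For disjoint A₁, A₂ a colour t of the common neighbour can only block when A₃ lies in
  -- (A₁ ∪ A₂) ∖ {t}; two blocking colours would squeeze A₃ into two colours.
  Blocking : List ℕ → List ℕ → ℕ → Set
  Blocking A₁ A₂ t = t ∉ A₃ × (t ∈ A₁ ⊎ t ∈ A₂) × (∀ {c} → c ∈ A₃ → c ∈ A₁ ⊎ c ∈ A₂)

  Blocking-swap : ∀ {A₁ A₂ t} → Blocking A₁ A₂ t → Blocking A₂ A₁ t
  Blocking-swap (t∉A₃ , t∈ , A₃⊆) = t∉A₃ , Sum.swap t∈ , Sum.swap ∘ A₃⊆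

  colour-shared : ∀ {A₁ A₂ s t} → s ∈ A₁ → s ∈ A₂ → s ≢ t → DiamondColouring A₁ A₂ A₃ A₄ f t
  colour-shared {s = s} s∈A₁ s∈A₂ s≢t =
    let avoiding c₃ c₃∈ c₃∉ = fresh u₃ ∣A₃∣ (s ∷ [])
        avoiding c₄ c₄∈ c₄∉ = fresh u₄ ∣A₄∣ (f ∷ s ∷ c₃ ∷ [])
        s≢c₃ = ≢-sym (∉⇒≢₀ c₃∉)
        s≢c₄ = ≢-sym (∉⇒≢₁ c₄∉)
    in diamond s s c₃ c₄ s∈A₁ s∈A₂ c₃∈ c₄∈ s≢t s≢t s≢c₃ s≢c₄ s≢c₃ s≢c₄ (≢-sym (∉⇒≢₂ c₄∉)) (∉⇒≢₀ c₄∉)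

  colour-given-c₁ : ∀ {A₁ b₁ b₂ p t} → b₁ ≢ b₂ → p ∈ A₁ → p ≢ t → t ∉ b₁ ∷ b₂ ∷ [] →
                    DiamondColouring A₁ (b₁ ∷ b₂ ∷ []) A₃ A₄ f t ⊎ A₃ ⊆ p ∷ b₁ ∷ b₂ ∷ []
  colour-given-c₁ {A₁} {b₁} {b₂} {p} {t} b₁≢b₂ p∈ p≢t t∉B with ⊈-witness-or-⊆ A₄ (f ∷ p ∷ b₁ ∷ b₂ ∷ [])
  ... | inj₁ (c₄ , c₄∈ , c₄∉) =
    let avoiding c₃ c₃∈ c₃∉ = fresh u₃ ∣A₃∣ (p ∷ c₄ ∷ [])
        avoiding c₂ c₂∈ c₂∉ = fresh (pair-unique b₁≢b₂) refl (c₃ ∷ [])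
    in inj₁ (diamond p c₂ c₃ c₄ p∈ c₂∈ c₃∈ c₄∈ p≢t (≢-sym (∉⇒≢ t∉B c₂∈))
                     (≢-sym (∉⇒≢₀ c₃∉)) (≢-sym (∉⇒≢₁ c₄∉)) (∉⇒≢₀ c₂∉)
                     (≢-sym (∉⇒≢ c₄∉ (there (there c₂∈)))) (∉⇒≢₁ c₃∉) (∉⇒≢₀ c₄∉))
  ... | inj₂ A₄⊆ with ⊈-witness-or-⊆ A₃ (p ∷ b₁ ∷ b₂ ∷ [])
  ...   | inj₂ A₃⊆ = inj₂ A₃⊆
  ...   | inj₁ (c₃ , c₃∈ , c₃∉) =
    let avoiding c₄ c₄∈ c₄∉ = fresh u₄ ∣A₄∣ (f ∷ p ∷ b₁ ∷ [])
        c₄≡b₂ = [ ⊥-elim ∘ c₄∉ , id ]′ (∈-snoc⁻ {xs = f ∷ p ∷ b₁ ∷ []} (A₄⊆ c₄∈))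
    in inj₁ (diamond p b₁ c₃ c₄ p∈ (here refl) c₃∈ c₄∈ p≢t (≢-sym (∉⇒≢₀ t∉B))
                     (≢-sym (∉⇒≢₀ c₃∉)) (≢-sym (∉⇒≢₁ c₄∉)) (≢-sym (∉⇒≢₁ c₃∉)) (≢-sym (∉⇒≢₂ c₄∉))
                     (λ c₃≡c₄ → ∉⇒≢₂ c₃∉ (trans c₃≡c₄ c₄≡b₂)) (∉⇒≢₀ c₄∉))

  colourable-or-blocking₁ : ∀ {A₁ b₁ b₂ p t} → b₁ ≢ b₂ → t ∈ A₁ → p ∈ A₁ → p ≢ t → t ∉ b₁ ∷ b₂ ∷ [] →
                            DiamondColouring A₁ (b₁ ∷ b₂ ∷ []) A₃ A₄ f t ⊎ Blocking A₁ (b₁ ∷ b₂ ∷ []) t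
  colourable-or-blocking₁ {A₁} {b₁} {b₂} {p} {t} b₁≢b₂ t∈ p∈ p≢t t∉B with colour-given-c₁ b₁≢b₂ p∈ p≢t t∉B
  ... | inj₁ col = inj₁ col
  ... | inj₂ A₃⊆ = inj₂ (∉-∷⁺ (≢-sym p≢t) t∉B ∘ A₃⊆ , inj₁ t∈ , A₃⊆A₁∪B)
    where
    A₃⊆A₁∪B : ∀ {c} → c ∈ A₃ → c ∈ A₁ ⊎ c ∈ b₁ ∷ b₂ ∷ []
    A₃⊆A₁∪B c∈ with A₃⊆ c∈
    ... | here refl = inj₁ p∈
    ... | there c∈B = inj₂ c∈B

  colourable-or-blocking : ∀ {a₁ a₂ b₁ b₂} → a₁ ≢ a₂ → b₁ ≢ b₂ →
                           (∀ {c} → c ∈ a₁ ∷ a₂ ∷ [] → c ∉ b₁ ∷ b₂ ∷ []) → ∀ t →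
                           DiamondColouring (a₁ ∷ a₂ ∷ []) (b₁ ∷ b₂ ∷ []) A₃ A₄ f t ⊎
                           Blocking (a₁ ∷ a₂ ∷ []) (b₁ ∷ b₂ ∷ []) t
  colourable-or-blocking {a₁} {a₂} {b₁} {b₂} a₁≢a₂ b₁≢b₂ disjoint t with t ∈? a₁ ∷ a₂ ∷ [] | t ∈? b₁ ∷ b₂ ∷ []
  ... | yes t∈A@(here refl) | _ =
    colourable-or-blocking₁ b₁≢b₂ t∈A (there (here refl)) (≢-sym a₁≢a₂) (disjoint t∈A)
  ... | yes t∈A@(there (here refl)) | _ =
    colourable-or-blocking₁ b₁≢b₂ t∈A (here refl) a₁≢a₂ (disjoint t∈A)
  ... | no t∉A | yes t∈B@(here refl) =
    Sum.map DiamondColouring-swap Blocking-swap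
            (colourable-or-blocking₁ a₁≢a₂ t∈B (there (here refl)) (≢-sym b₁≢b₂) t∉A)
  ... | no t∉A | yes t∈B@(there (here refl)) =
    Sum.map DiamondColouring-swap Blocking-swap
            (colourable-or-blocking₁ a₁≢a₂ t∈B (here refl) b₁≢b₂ t∉A)
  ... | no t∉A | no t∉B
    with colour-given-c₁ b₁≢b₂ (here refl) (≢-sym (∉⇒≢₀ t∉A)) t∉B
       | colour-given-c₁ b₁≢b₂ (there (here refl)) (≢-sym (∉⇒≢₁ t∉A)) t∉B
  ...   | inj₁ col | _        = inj₁ col
  ...   | inj₂ _   | inj₁ col = inj₁ col
  ...   | inj₂ A₃⊆a₁∷B | inj₂ A₃⊆a₂∷B =
    ⊥-elim (pigeonhole u₃ (⊆-∷-both a₁≢a₂ A₃⊆a₁∷B A₃⊆a₂∷B) ∣A₃∣ refl)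

  blocking-unique : ∀ {a₁ a₂ b₁ b₂ t t′} →
                    Blocking (a₁ ∷ a₂ ∷ []) (b₁ ∷ b₂ ∷ []) t → Blocking (a₁ ∷ a₂ ∷ []) (b₁ ∷ b₂ ∷ []) t′ → t ≡ t′
  blocking-unique {a₁} {a₂} {b₁} {b₂} {t} {t′} (t∉A₃ , t∈ , A₃⊆) (t′∉A₃ , t′∈ , _) with t ≟ t′
  ... | yes t≡t′ = t≡t′
  ... | no t≢t′  = ⊥-elim (pigeonhole (Unique-∷⁺ (∉-∷⁺ t≢t′ t∉A₃) (Unique-∷⁺ t′∉A₃ u₃)) ⊆A∪B
                                      (cong (suc ∘ suc) ∣A₃∣) refl)
    where
    A∪B : List ℕ
    A∪B = a₁ ∷ a₂ ∷ b₁ ∷ b₂ ∷ []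
    inj-∪ : ∀ {c} → c ∈ a₁ ∷ a₂ ∷ [] ⊎ c ∈ b₁ ∷ b₂ ∷ [] → c ∈ A∪B
    inj-∪ = [ ∈-++⁺ˡ , ∈-++⁺ʳ (a₁ ∷ a₂ ∷ []) ]′
    ⊆A∪B : t ∷ t′ ∷ A₃ ⊆ A∪B
    ⊆A∪B (here refl)         = inj-∪ t∈
    ⊆A∪B (there (here refl)) = inj-∪ t′∈
    ⊆A∪B (there (there c∈))  = inj-∪ (A₃⊆ c∈)

  one-bad-colour : ∀ {A₁ A₂} → Unique A₁ → Unique A₂ → length A₁ ≡ 2 → length A₂ ≡ 2 →
                   ∃ λ d → ∀ t → t ≢ d → DiamondColouring A₁ A₂ A₃ A₄ f t
  one-bad-colour {a₁ ∷ a₂ ∷ []} {b₁ ∷ b₂ ∷ []} ((a₁≢a₂ ∷ []) ∷ _) ((b₁≢b₂ ∷ []) ∷ _) refl refl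
    with exists-or-forall (λ a → toSum (a ∈? b₁ ∷ b₂ ∷ [])) (a₁ ∷ a₂ ∷ [])
  ... | inj₁ (s , s∈A , s∈B) = s , λ t t≢s → colour-shared s∈A s∈B (≢-sym t≢s)
  ... | inj₂ disjoint =
    all-but-one (colourable-or-blocking a₁≢a₂ b₁≢b₂ disjoint) blocking-unique
                (a₁ ∷ a₂ ∷ b₁ ∷ b₂ ∷ []) (λ (_ , t∈ , _) → [ ∈-++⁺ˡ , ∈-++⁺ʳ (a₁ ∷ a₂ ∷ []) ]′ t∈)

-- U₂Slack α β: u₂ keeps a colour whatever the hub gets; PathSlack α β: the path u₄u₅ can be
-- coloured whatever the hub gets, provided it avoids α.
module Wheel (Lv₁ Lu₂ Lv₃ Lu₄ Lu₅ Ly₁ : List ℕ)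
             (uv₁ : Unique Lv₁) (uu₂ : Unique Lu₂) (uv₃ : Unique Lv₃)
             (uu₄ : Unique Lu₄) (uu₅ : Unique Lu₅) (uy₁ : Unique Ly₁)
             (∣Lv₁∣ : length Lv₁ ≡ 3) (∣Lu₂∣ : length Lu₂ ≡ 3) (∣Lv₃∣ : length Lv₃ ≡ 3)
             (∣Lu₄∣ : length Lu₄ ≡ 3) (∣Lu₅∣ : length Lu₅ ≡ 3) (∣Ly₁∣ : length Ly₁ ≡ 4) where

  record PathColouring (α β y : ℕ) : Set where
    constructor path
    field
      c₄ c₅ : ℕ
      c₄∈ : c₄ ∈ Lu₄
      c₅∈ : c₅ ∈ Lu₅
      c₄≢β : c₄ ≢ β
      c₄≢y : c₄ ≢ y
      c₄≢c₅ : c₄ ≢ c₅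
      c₅≢α : c₅ ≢ α
      c₅≢y : c₅ ≢ y

  record WheelColouring (α β y : ℕ) : Set where
    constructor wheel
    field
      y∈ : y ∈ Ly₁
      y≢α : y ≢ α
      y≢β : y ≢ β
      spoke : Avoiding Lu₂ (α ∷ β ∷ y ∷ [])
      rest : PathColouring α β y

  U₂Slack U₂Tight PathSlack PathTight : ℕ → ℕ → Set
  U₂Slack α β = α ≡ β ⊎ α ∉ Lu₂ ⊎ β ∉ Lu₂
  U₂Tight α β = α ≢ β × α ∈ Lu₂ × β ∈ Lu₂
  PathSlack α β = β ∉ Lu₄ ⊎ α ∉ Lu₅ ⊎ ∃ λ x → x ∈ Lu₄ × x ≢ β × (x ∉ Lu₅ ⊎ x ≡ α)
  PathTight α β = β ∈ Lu₄ × α ∈ Lu₅ × (∀ {x} → x ∈ Lu₄ → x ≢ β → x ∈ Lu₅ × x ≢ α)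

  u₂-colour : ∀ {α β} → U₂Slack α β → ∀ y → Avoiding Lu₂ (α ∷ β ∷ y ∷ [])
  u₂-colour (inj₁ refl) y =
    let avoiding c c∈ c∉ = fresh uu₂ ∣Lu₂∣ (_ ∷ y ∷ []) in avoiding c c∈ (∉-∷⁺ (∉⇒≢₀ c∉) c∉)
  u₂-colour (inj₂ (inj₁ α∉)) y =
    let avoiding c c∈ c∉ = fresh uu₂ ∣Lu₂∣ (_ ∷ y ∷ []) in avoiding c c∈ (∉-∷⁺ (≢-sym (∉⇒≢ α∉ c∈)) c∉)
  u₂-colour (inj₂ (inj₂ β∉)) y =
    let avoiding c c∈ c∉ = fresh uu₂ ∣Lu₂∣ (_ ∷ y ∷ [])
    in avoiding c c∈ (∉-∷⁺ (∉⇒≢₀ c∉) (∉-∷⁺ (≢-sym (∉⇒≢ β∉ c∈)) (c∉ ∘ there)))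

  path-colour : ∀ {α β y} → y ≢ α → PathSlack α β → PathColouring α β y
  path-colour {α} {β} {y} y≢α (inj₁ β∉) =
    let avoiding c₅ c₅∈ c₅∉ = fresh uu₅ ∣Lu₅∣ (α ∷ y ∷ [])
        avoiding c₄ c₄∈ c₄∉ = fresh uu₄ ∣Lu₄∣ (y ∷ c₅ ∷ [])
    in path c₄ c₅ c₄∈ c₅∈ (≢-sym (∉⇒≢ β∉ c₄∈)) (∉⇒≢₀ c₄∉) (∉⇒≢₁ c₄∉) (∉⇒≢₀ c₅∉) (∉⇒≢₁ c₅∉)
  path-colour {α} {β} {y} y≢α (inj₂ (inj₁ α∉)) =
    let avoiding c₄ c₄∈ c₄∉ = fresh uu₄ ∣Lu₄∣ (β ∷ y ∷ [])
        avoiding c₅ c₅∈ c₅∉ = fresh uu₅ ∣Lu₅∣ (y ∷ c₄ ∷ [])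
    in path c₄ c₅ c₄∈ c₅∈ (∉⇒≢₀ c₄∉) (∉⇒≢₁ c₄∉) (≢-sym (∉⇒≢₁ c₅∉)) (≢-sym (∉⇒≢ α∉ c₅∈)) (∉⇒≢₀ c₅∉)
  path-colour {α} {β} {y} y≢α (inj₂ (inj₂ (x , x∈ , x≢β , x-free))) with y ≟ x
  ... | yes refl =
    let y∉Lu₅ = [ id , ⊥-elim ∘ y≢α ]′ x-free
        avoiding c₄ c₄∈ c₄∉ = fresh uu₄ ∣Lu₄∣ (β ∷ y ∷ [])
        avoiding c₅ c₅∈ c₅∉ = fresh uu₅ ∣Lu₅∣ (α ∷ c₄ ∷ [])
    in path c₄ c₅ c₄∈ c₅∈ (∉⇒≢₀ c₄∉) (∉⇒≢₁ c₄∉) (≢-sym (∉⇒≢₁ c₅∉)) (∉⇒≢₀ c₅∉) (≢-sym (∉⇒≢ y∉Lu₅ c₅∈))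
  ... | no y≢x =
    let avoiding c₅ c₅∈ c₅∉ = fresh uu₅ ∣Lu₅∣ (α ∷ y ∷ [])
        x≢c₅ = [ (λ x∉ → ∉⇒≢ x∉ c₅∈) , (λ { refl → ≢-sym (∉⇒≢₀ c₅∉) }) ]′ x-free
    in path x c₅ x∈ c₅∈ x≢β (≢-sym y≢x) x≢c₅ (∉⇒≢₀ c₅∉) (∉⇒≢₁ c₅∉)

  Slack Tight : ℕ → ℕ → Set
  Slack α β = U₂Slack α β × PathSlack α β
  Tight α β = U₂Tight α β ⊎ PathTight α β

  wheel-colour : ∀ {α β y} → Slack α β → y ∈ Ly₁ → y ≢ α → y ≢ β → WheelColouring α β y
  wheel-colour {y = y} (u₂-slack , path-slack) y∈ y≢α y≢β =
    wheel y∈ y≢α y≢β (u₂-colour u₂-slack y) (path-colour y≢α path-slack)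

  u₂-slack-or-tight : ∀ α β → U₂Slack α β ⊎ U₂Tight α β
  u₂-slack-or-tight α β with α ≟ β | α ∈? Lu₂ | β ∈? Lu₂
  ... | yes α≡β | _      | _      = inj₁ (inj₁ α≡β)
  ... | no _    | no α∉  | _      = inj₁ (inj₂ (inj₁ α∉))
  ... | no _    | yes _  | no β∉  = inj₁ (inj₂ (inj₂ β∉))
  ... | no α≢β  | yes α∈ | yes β∈ = inj₂ (α≢β , α∈ , β∈)

  path-slack-or-tight : ∀ α β → PathSlack α β ⊎ PathTight α β
  path-slack-or-tight α β with β ∈? Lu₄ | α ∈? Lu₅
  ... | no β∉ | _ = inj₁ (inj₁ β∉)
  ... | yes _ | no α∉ = inj₁ (inj₂ (inj₁ α∉))
  ... | yes β∈ | yes α∈ with exists-or-forall escapes-or-trapped Lu₄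
    where
    escapes-or-trapped : ∀ x → (x ≢ β × (x ∉ Lu₅ ⊎ x ≡ α)) ⊎ (x ≢ β → x ∈ Lu₅ × x ≢ α)
    escapes-or-trapped x with x ≟ β | x ∈? Lu₅ | x ≟ α
    ... | yes x≡β | _      | _       = inj₂ λ x≢β → ⊥-elim (x≢β x≡β)
    ... | no x≢β  | no x∉  | _       = inj₁ (x≢β , inj₁ x∉)
    ... | no x≢β  | yes _  | yes x≡α = inj₁ (x≢β , inj₂ x≡α)
    ... | no _    | yes x∈ | no x≢α  = inj₂ λ _ → x∈ , x≢α
  ...   | inj₁ (x , x∈ , escapes) = inj₁ (inj₂ (inj₂ (x , x∈ , escapes)))
  ...   | inj₂ trapped            = inj₂ (β∈ , α∈ , λ x∈ → trapped x∈)

  slack-or-tight : ∀ α β → Slack α β ⊎ Tight α β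
  slack-or-tight α β with u₂-slack-or-tight α β | path-slack-or-tight α β
  ... | inj₁ u₂-slack | inj₁ path-slack = inj₁ (u₂-slack , path-slack)
  ... | inj₂ u₂-tight | _               = inj₂ (inj₁ u₂-tight)
  ... | inj₁ _        | inj₂ path-tight = inj₂ (inj₂ path-tight)

  data Outcome : Set where
    flexible : ∀ {α β y y′} → α ∈ Lv₁ → β ∈ Lv₃ → y ≢ y′ →
               WheelColouring α β y → WheelColouring α β y′ → Outcome
    rigid    : (∀ c → c ∈ Lv₁ ⇔ c ∈ Lv₃) →
               (∀ {α β} → α ∈ Lv₁ → β ∈ Lv₃ → ∃ (WheelColouring α β)) → Outcome

  module AllTight (tight : ∀ {α β} → α ∈ Lv₁ → β ∈ Lv₃ → Tight α β) where

    path-tight : ∀ {α β} → ¬ U₂Tight α β → α ∈ Lv₁ → β ∈ Lv₃ → PathTight α β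
    path-tight ¬u₂-tight α∈ β∈ = [ ⊥-elim ∘ ¬u₂-tight , id ]′ (tight α∈ β∈)

    Lv₁⊆Lu₂ : Lv₁ ⊆ Lu₂
    Lv₁⊆Lu₂ {α} α∈ with α ∈? Lu₂
    ... | yes α∈Lu₂ = α∈Lu₂
    ... | no  α∉Lu₂ = ⊥-elim (pigeonhole (Unique-∷⁺ α∉Lu₄ uu₄) α∷Lu₄⊆Lu₅ (cong suc ∣Lu₄∣) ∣Lu₅∣)
      where
      β₁ : Avoiding Lv₃ []
      β₁ = fresh uv₃ ∣Lv₃∣ []
      β₂ : Avoiding Lv₃ (Avoiding.colour β₁ ∷ [])
      β₂ = fresh uv₃ ∣Lv₃∣ _
      tight₁ : PathTight α (Avoiding.colour β₁)
      tight₁ = path-tight (α∉Lu₂ ∘ proj₁ ∘ proj₂) α∈ (Avoiding.allowed β₁)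
      tight₂ : PathTight α (Avoiding.colour β₂)
      tight₂ = path-tight (α∉Lu₂ ∘ proj₁ ∘ proj₂) α∈ (Avoiding.allowed β₂)
      trapped : ∀ {x} → x ∈ Lu₄ → x ∈ Lu₅ × x ≢ α
      trapped {x} x∈ with x ≟ Avoiding.colour β₁
      ... | no x≢β₁ = proj₂ (proj₂ tight₁) x∈ x≢β₁
      ... | yes refl = proj₂ (proj₂ tight₂) x∈ (≢-sym (∉⇒≢₀ (Avoiding.avoids β₂)))
      α∉Lu₄ : α ∉ Lu₄
      α∉Lu₄ α∈Lu₄ = proj₂ (trapped α∈Lu₄) refl
      α∷Lu₄⊆Lu₅ : α ∷ Lu₄ ⊆ Lu₅
      α∷Lu₄⊆Lu₅ (here refl) = proj₁ (proj₂ tight₁)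
      α∷Lu₄⊆Lu₅ (there x∈)  = proj₁ (trapped x∈)

    Lv₃⊆Lu₂ : Lv₃ ⊆ Lu₂
    Lv₃⊆Lu₂ {β} β∈ with β ∈? Lu₂
    ... | yes β∈Lu₂ = β∈Lu₂
    ... | no  β∉Lu₂ = ⊥-elim (pigeonhole unique ⊆Lu₅ refl ∣Lu₅∣)
      where
      open Avoiding
      α₁ : Avoiding Lv₁ []
      α₁ = fresh uv₁ ∣Lv₁∣ []
      α₂ : Avoiding Lv₁ (colour α₁ ∷ [])
      α₂ = fresh uv₁ ∣Lv₁∣ _
      x₁ : Avoiding Lu₄ (β ∷ [])
      x₁ = fresh uu₄ ∣Lu₄∣ _
      x₂ : Avoiding Lu₄ (β ∷ colour x₁ ∷ [])
      x₂ = fresh uu₄ ∣Lu₄∣ _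
      tight₁ : PathTight (colour α₁) β
      tight₁ = path-tight (β∉Lu₂ ∘ proj₂ ∘ proj₂) (allowed α₁) β∈
      tight₂ : PathTight (colour α₂) β
      tight₂ = path-tight (β∉Lu₂ ∘ proj₂ ∘ proj₂) (allowed α₂) β∈
      trapped₁ : ∀ {x} → x ∈ Lu₄ → x ≢ β → x ∈ Lu₅ × x ≢ colour α₁
      trapped₁ = proj₂ (proj₂ tight₁)
      trapped₂ : ∀ {x} → x ∈ Lu₄ → x ≢ β → x ∈ Lu₅ × x ≢ colour α₂
      trapped₂ = proj₂ (proj₂ tight₂)
      x₁≢β : colour x₁ ≢ β
      x₁≢β = ∉⇒≢₀ (avoids x₁)
      x₂≢β : colour x₂ ≢ β
      x₂≢β = ∉⇒≢₀ (avoids x₂)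
      unique : Unique (colour α₁ ∷ colour α₂ ∷ colour x₁ ∷ colour x₂ ∷ [])
      unique = Unique-∷⁺ (∉-∷⁺ (≢-sym (∉⇒≢₀ (avoids α₂)))
                         (∉-∷⁺ (≢-sym (proj₂ (trapped₁ (allowed x₁) x₁≢β)))
                         (∉-∷⁺ (≢-sym (proj₂ (trapped₁ (allowed x₂) x₂≢β))) λ ())))
               (Unique-∷⁺ (∉-∷⁺ (≢-sym (proj₂ (trapped₂ (allowed x₁) x₁≢β)))
                          (∉-∷⁺ (≢-sym (proj₂ (trapped₂ (allowed x₂) x₂≢β))) λ ()))
               (pair-unique (≢-sym (∉⇒≢₁ (avoids x₂)))))
      ⊆Lu₅ : colour α₁ ∷ colour α₂ ∷ colour x₁ ∷ colour x₂ ∷ [] ⊆ Lu₅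
      ⊆Lu₅ (here refl)                         = proj₁ (proj₂ tight₁)
      ⊆Lu₅ (there (here refl))                 = proj₁ (proj₂ tight₂)
      ⊆Lu₅ (there (there (here refl)))         = proj₁ (trapped₁ (allowed x₁) x₁≢β)
      ⊆Lu₅ (there (there (there (here refl)))) = proj₁ (trapped₁ (allowed x₂) x₂≢β)

    Lu₂⊆Lv₁ : Lu₂ ⊆ Lv₁
    Lu₂⊆Lv₁ = Unique∧⊆∧length≡⇒⊇ uv₁ Lv₁⊆Lu₂ (trans ∣Lu₂∣ (sym ∣Lv₁∣))

    Lv₁⊆Lv₃ : Lv₁ ⊆ Lv₃
    Lv₁⊆Lv₃ = Unique∧⊆∧length≡⇒⊇ uv₃ Lv₃⊆Lu₂ (trans ∣Lu₂∣ (sym ∣Lv₃∣)) ∘ Lv₁⊆Lu₂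

    Lv₃⊆Lv₁ : Lv₃ ⊆ Lv₁
    Lv₃⊆Lv₁ = Lu₂⊆Lv₁ ∘ Lv₃⊆Lu₂

    diagonal-tight : ∀ {α} → α ∈ Lv₁ → PathTight α α
    diagonal-tight α∈ = path-tight (λ (α≢α , _) → α≢α refl) α∈ (Lv₁⊆Lv₃ α∈)

    Lu₄⊆Lv₁ : Lu₄ ⊆ Lv₁
    Lu₄⊆Lv₁ = Unique∧⊆∧length≡⇒⊇ uv₁ (proj₁ ∘ diagonal-tight) (trans ∣Lu₄∣ (sym ∣Lv₁∣))

    Lu₅⊆Lv₁ : Lu₅ ⊆ Lv₁
    Lu₅⊆Lv₁ = Unique∧⊆∧length≡⇒⊇ uv₁ (proj₁ ∘ proj₂ ∘ diagonal-tight) (trans ∣Lu₅∣ (sym ∣Lv₁∣))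

    -- All rim lists equal Lv₁, so a hub colour outside Lv₁ conflicts with nothing.
    colour-off-rim : ∀ {α β} → α ∈ Lv₁ → β ∈ Lv₃ → ∃ (WheelColouring α β)
    colour-off-rim {α} {β} α∈ β∈ =
      h , wheel h∈ (≢-sym (off-rim α∈)) (≢-sym (off-rim (Lv₃⊆Lv₁ β∈)))
                (avoiding c₂ c₂∈ (∉-∷⁺ (∉⇒≢₀ c₂∉) (∉-∷⁺ (∉⇒≢₁ c₂∉) (∉-∷⁺ (off-rim (Lu₂⊆Lv₁ c₂∈)) λ ()))))
                (path c₄ c₅ c₄∈ c₅∈ (∉⇒≢₀ c₄∉) (off-rim (Lu₄⊆Lv₁ c₄∈)) (≢-sym (∉⇒≢₁ c₅∉)) (∉⇒≢₀ c₅∉)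
                      (off-rim (Lu₅⊆Lv₁ c₅∈)))
      where
      hub : Avoiding Ly₁ Lv₁
      hub = avoiding-< uy₁ (subst₂ _<_ (sym ∣Lv₁∣) (sym ∣Ly₁∣) ≤-refl)
      open Avoiding hub renaming (colour to h; allowed to h∈; avoids to h∉)
      off-rim : ∀ {c} → c ∈ Lv₁ → c ≢ h
      off-rim c∈ = ≢-sym (∉⇒≢ h∉ c∈)
      open Avoiding (fresh uu₂ ∣Lu₂∣ (α ∷ β ∷ [])) renaming (colour to c₂; allowed to c₂∈; avoids to c₂∉)
      open Avoiding (fresh uu₄ ∣Lu₄∣ (β ∷ [])) renaming (colour to c₄; allowed to c₄∈; avoids to c₄∉)
      open Avoiding (fresh uu₅ ∣Lu₅∣ (α ∷ c₄ ∷ [])) renaming (colour to c₅; allowed to c₅∈; avoids to c₅∉)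

  outcome : Outcome
  outcome with exists-or-forall (λ α → exists-or-forall (slack-or-tight α) Lv₃) Lv₁
  ... | inj₁ (α , α∈ , β , β∈ , slack) =
    let avoiding y  y∈  y∉  = fresh uy₁ ∣Ly₁∣ (α ∷ β ∷ [])
        avoiding y′ y′∈ y′∉ = fresh uy₁ ∣Ly₁∣ (α ∷ β ∷ y ∷ [])
    in flexible α∈ β∈ (≢-sym (∉⇒≢₂ y′∉))
                (wheel-colour slack y∈ (∉⇒≢₀ y∉) (∉⇒≢₁ y∉)) (wheel-colour slack y′∈ (∉⇒≢₀ y′∉) (∉⇒≢₁ y′∉))
  ... | inj₂ tight = rigid (λ _ → mk⇔ Lv₁⊆Lv₃ Lv₃⊆Lv₁) colour-off-rim
    where open AllTight (λ α∈ β∈ → tight α∈ β∈)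

terminal : V → Bool
terminal v1         = true
terminal v3         = true
terminal (w' _ k3)  = true
terminal _          = false

terminals-independent : ∀ {u v} → T (terminal u) → T (terminal v) → ¬ Adj u v
terminals-independent {u} {v} tu tv (inj₁ uv∈) = All.lookup no-terminal-edge uv∈ (tu , tv)
  where
  no-terminal-edge : All (λ e → ¬ (T (terminal (proj₁ e)) × T (terminal (proj₂ e)))) edges
  no-terminal-edge = from-yes (All.all? (λ e → ¬? (T? (terminal (proj₁ e)) ×-dec T? (terminal (proj₂ e)))) edges)
terminals-independent tu tv (inj₂ vu∈) = terminals-independent tv tu (inj₁ vu∈)

Proper : (V → ℕ) → V × V → Set
Proper φ (u , v) = φ u ≢ φ v

proper-on-edges : ∀ {φ} → All (Proper φ) edges → ∀ u v → Adj u v → φ u ≢ φ v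
proper-on-edges proper u v (inj₁ uv∈) = All.lookup proper uv∈
proper-on-edges proper u v (inj₂ vu∈) = ≢-sym (All.lookup proper vu∈)

terminal-pair-colouring : ∀ {L a b ψ} → T (terminal a) → T (terminal b) → ψ a ∈ L a → ψ b ∈ L b →
                          IsLColoringOn L (Pair a b) ψ
terminal-pair-colouring {L} {a} {b} {ψ} ta tb ψa∈ ψb∈ = allowed , λ u v u∈ v∈ adj → ⊥-elim (terminals-independent (terminal-of u∈) (terminal-of v∈) adj)
  where
  allowed : ∀ v → Pair a b v → ψ v ∈ L v
  allowed _ (inj₁ refl) = ψa∈
  allowed _ (inj₂ refl) = ψb∈
  terminal-of : ∀ {v} → Pair a b v → T (terminal v)
  terminal-of (inj₁ refl) = ta
  terminal-of (inj₂ refl) = tb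

∉-pairᵢ : ∀ {f : I → ℕ} → x ∉ f i1 ∷ f i2 ∷ [] → ∀ i → x ≢ f i
∉-pairᵢ x∉ i1 = ∉⇒≢₀ x∉
∉-pairᵢ x∉ i2 = ∉⇒≢₁ x∉

S : Subset
S = Pair (w' i1 k3) (w' i2 k3)

module HalfListAssignment (L : ListAssignment) (half : IsHalfList L) where

  unique : ∀ v → Unique (L v)
  unique v = proj₁ (half v)

  halfLength : ∀ v → length (L v) ≡ length (L4 v) / 2
  halfLength v = trans (sym (m*n/n≡m (length (L v)) 2)) (cong (_/ 2) (proj₂ (half v)))

  pick : ∀ v ys → {True (length ys <? length (L4 v) / 2)} → Avoiding (L v) ys
  pick v ys {∣ys∣<} = fresh (unique v) (halfLength v) ys {∣ys∣<}

  open Avoiding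
  open Wheel (L v1) (L u2) (L v3) (L u4) (L u5) (L y1)
             (unique v1) (unique u2) (unique v3) (unique u4) (unique u5) (unique y1)
             (halfLength v1) (halfLength u2) (halfLength v3) (halfLength u4) (halfLength u5) (halfLength y1)

  diamond-at : ∀ i f → ∃ λ d → ∀ t → t ≢ d → DiamondColouring (L (z i j1)) (L (z i j2)) (L (z i j3)) (L (z i j4)) f t
  diamond-at i f = Diamond.one-bad-colour (unique (z i j3)) (unique (z i j4)) (halfLength (z i j3)) (halfLength (z i j4)) f
                                          (unique (z i j1)) (unique (z i j2)) (halfLength (z i j1)) (halfLength (z i j2))

  wheel-edges : List (V × V)
  wheel-edges = (v1 , u2) ∷ (u2 , v3) ∷ (v3 , u4) ∷ (u4 , u5) ∷ (u5 , v1) ∷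
                (y1 , v1) ∷ (y1 , u2) ∷ (y1 , v3) ∷ (y1 , u4) ∷ (y1 , u5) ∷ []

  withWheel : ∀ {α β h} → WheelColouring α β h → (V → ℕ) → V → ℕ
  withWheel {α = α} W ρ v1 = α
  withWheel {β = β} W ρ v3 = β
  withWheel {h = h} W ρ y1 = h
  withWheel         W ρ u2 = colour (WheelColouring.spoke W)
  withWheel         W ρ u4 = PathColouring.c₄ (WheelColouring.rest W)
  withWheel         W ρ u5 = PathColouring.c₅ (WheelColouring.rest W)
  withWheel         W ρ v  = ρ v

  withWheel-proper : ∀ {α β h} (W : WheelColouring α β h) ρ → All (Proper (withWheel W ρ)) wheel-edges
  withWheel-proper (wheel _ h≢α h≢β (avoiding _ _ c₂∉) (path _ _ _ _ c₄≢β c₄≢h c₄≢c₅ c₅≢α c₅≢h)) ρ =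
    ≢-sym (∉⇒≢₀ c₂∉) ∷ ∉⇒≢₁ c₂∉ ∷ ≢-sym c₄≢β ∷ c₄≢c₅ ∷ c₅≢α ∷
    h≢α ∷ ≢-sym (∉⇒≢₂ c₂∉) ∷ h≢β ∷ ≢-sym c₄≢h ∷ ≢-sym c₅≢h ∷ []

  module PrecolouredEnds {α β y y′} (α∈ : α ∈ L v1) (β∈ : β ∈ L v3) (y≢y′ : y ≢ y′)
                         (W : WheelColouring α β y) (W′ : WheelColouring α β y′) where

    ψ₀ : V → ℕ
    ψ₀ v1 = α
    ψ₀ v3 = β
    ψ₀ _  = 0

    ψ₀-colouring : IsLColoringOn L (Pair v1 v3) ψ₀
    ψ₀-colouring = terminal-pair-colouring tt tt α∈ β∈

    module Extend (φ : V → ℕ) (φ-colouring : IsLColoringOn L (S ∪ Pair v1 v3) φ)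
                  (ψ₀≗φ : AgreeOn (Pair v1 v3) ψ₀ φ) where

      c : I → ℕ
      c i = φ (w' i k3)

      w′₂ : ∀ i → Avoiding (L (w' i k2)) (c i ∷ [])
      w′₂ i = pick (w' i k2) _
      w′₁ : ∀ i → Avoiding (L (w' i k1)) (c i ∷ colour (w′₂ i) ∷ [])
      w′₁ i = pick (w' i k1) _
      w₃ : Avoiding (L w3) (colour (w′₁ i1) ∷ colour (w′₁ i2) ∷ [])
      w₃ = pick w3 _
      w₂ : Avoiding (L w2) (colour w₃ ∷ [])
      w₂ = pick w2 _
      w₁ : Avoiding (L w1) (colour w₃ ∷ colour w₂ ∷ [])
      w₁ = pick w1 _
      z₆ : ∀ i → Avoiding (L (z i j6)) []
      z₆ i = pick (z i j6) _
      z₇ : ∀ i → Avoiding (L (z i j7)) (colour w₁ ∷ colour (z₆ i) ∷ [])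
      z₇ i = pick (z i j7) _
      z₅ : ∀ i → Avoiding (L (z i j5)) (colour (z₆ i) ∷ colour (z₇ i) ∷ [])
      z₅ i = pick (z i j5) _

      bad : I → ℕ
      bad i = proj₁ (diamond-at i (colour (z₅ i)))

      y₄ : Avoiding (L y4) (bad i1 ∷ bad i2 ∷ [])
      y₄ = pick y4 _
      y₃ : Avoiding (L y3) (colour y₄ ∷ [])
      y₃ = pick y3 _
      y₂ : Avoiding (L y2) (colour y₄ ∷ colour y₃ ∷ [])
      y₂ = pick y2 _

      zᵢ : ∀ i → DiamondColouring (L (z i j1)) (L (z i j2)) (L (z i j3)) (L (z i j4)) (colour (z₅ i)) (colour y₄)
      zᵢ i = proj₂ (diamond-at i (colour (z₅ i))) (colour y₄) (∉-pairᵢ {f = bad} (avoids y₄) i)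

      hub : ∃ λ h → WheelColouring α β h × h ≢ colour y₂
      hub with y ≟ colour y₂
      ... | yes refl = y′ , W′ , ≢-sym y≢y′
      ... | no y≢y₂  = y , W , y≢y₂

      ρ : V → ℕ
      ρ y2 = colour y₂
      ρ y3 = colour y₃
      ρ y4 = colour y₄
      ρ (z i j1) = DiamondColouring.c₁ (zᵢ i)
      ρ (z i j2) = DiamondColouring.c₂ (zᵢ i)
      ρ (z i j3) = DiamondColouring.c₃ (zᵢ i)
      ρ (z i j4) = DiamondColouring.c₄ (zᵢ i)
      ρ (z i j5) = colour (z₅ i)
      ρ (z i j6) = colour (z₆ i)
      ρ (z i j7) = colour (z₇ i)
      ρ w1 = colour w₁
      ρ w2 = colour w₂
      ρ w3 = colour w₃
      ρ (w' i k1) = colour (w′₁ i)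
      ρ (w' i k2) = colour (w′₂ i)
      ρ (w' i k3) = c i
      ρ _ = 0

      φ′ : V → ℕ
      φ′ = withWheel (proj₁ (proj₂ hub)) ρ

      φ′-allowed : ∀ v → φ′ v ∈ L v
      φ′-allowed v1 = α∈
      φ′-allowed u2 = allowed (WheelColouring.spoke (proj₁ (proj₂ hub)))
      φ′-allowed v3 = β∈
      φ′-allowed u4 = PathColouring.c₄∈ (WheelColouring.rest (proj₁ (proj₂ hub)))
      φ′-allowed u5 = PathColouring.c₅∈ (WheelColouring.rest (proj₁ (proj₂ hub)))
      φ′-allowed y1 = WheelColouring.y∈ (proj₁ (proj₂ hub))
      φ′-allowed y2 = allowed y₂
      φ′-allowed y3 = allowed y₃
      φ′-allowed y4 = allowed y₄
      φ′-allowed (z i j1) = DiamondColouring.c₁∈ (zᵢ i)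
      φ′-allowed (z i j2) = DiamondColouring.c₂∈ (zᵢ i)
      φ′-allowed (z i j3) = DiamondColouring.c₃∈ (zᵢ i)
      φ′-allowed (z i j4) = DiamondColouring.c₄∈ (zᵢ i)
      φ′-allowed (z i j5) = allowed (z₅ i)
      φ′-allowed (z i j6) = allowed (z₆ i)
      φ′-allowed (z i j7) = allowed (z₇ i)
      φ′-allowed w1 = allowed w₁
      φ′-allowed w2 = allowed w₂
      φ′-allowed w3 = allowed w₃
      φ′-allowed (w' i k1) = allowed (w′₁ i)
      φ′-allowed (w' i k2) = allowed (w′₂ i)
      φ′-allowed (w' i1 k3) = proj₁ φ-colouring _ (inj₁ (inj₁ refl))
      φ′-allowed (w' i2 k3) = proj₁ φ-colouring _ (inj₁ (inj₂ refl))

      edgesᵢ-proper : ∀ i → All (Proper φ′) (edgesᵢ i)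
      edgesᵢ-proper i =
        ≢-sym c₁≢t ∷ ≢-sym c₂≢t ∷ c₁≢c₃ ∷ c₁≢c₄ ∷ c₂≢c₃ ∷ c₂≢c₄ ∷ c₃≢c₄ ∷
        ∉⇒≢₀ (avoids (z₅ i)) ∷ ≢-sym (∉⇒≢₁ (avoids (z₇ i))) ∷ ∉⇒≢₁ (avoids (z₅ i)) ∷ c₄≢f ∷
        ∉⇒≢₁ (avoids (w′₁ i)) ∷ ∉⇒≢₀ (avoids (w′₂ i)) ∷ ∉⇒≢₀ (avoids (w′₁ i)) ∷
        ∉⇒≢₀ (avoids (z₇ i)) ∷ ∉-pairᵢ {f = colour ∘ w′₁} (avoids w₃) i ∷ []
        where open DiamondColouring (zᵢ i)

      φ′-proper : All (Proper φ′) edges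
      φ′-proper = All-++⁺ {xs = wheel-edges} (withWheel-proper (proj₁ (proj₂ hub)) ρ)
        ( ∉⇒≢₁ (avoids y₂) ∷ ∉⇒≢₀ (avoids y₃) ∷ ∉⇒≢₀ (avoids y₂) ∷ proj₂ (proj₂ hub) ∷
          ∉⇒≢₁ (avoids w₁) ∷ ∉⇒≢₀ (avoids w₂) ∷ ∉⇒≢₀ (avoids w₁) ∷
          All-++⁺ (edgesᵢ-proper i1) (edgesᵢ-proper i2))

      φ≗φ′ : AgreeOn (S ∪ Pair v1 v3) φ φ′
      φ≗φ′ _ (inj₁ (inj₁ refl)) = refl
      φ≗φ′ _ (inj₁ (inj₂ refl)) = refl
      φ≗φ′ _ (inj₂ (inj₁ refl)) = sym (ψ₀≗φ v1 (inj₁ refl))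
      φ≗φ′ _ (inj₂ (inj₂ refl)) = sym (ψ₀≗φ v3 (inj₂ refl))

    extends : ExtendsAll L (Pair v1 v3) (S ∪ Pair v1 v3) ψ₀
    extends φ φ-colouring ψ₀≗φ =
      φ′ , ((λ v _ → φ′-allowed v) , λ u v _ _ → proper-on-edges φ′-proper u v) , φ≗φ′
      where open Extend φ φ-colouring ψ₀≗φ

  module PrecolouredS (wheels : ∀ {α β} → α ∈ L v1 → β ∈ L v3 → ∃ (WheelColouring α β)) where

    outside : ∀ i → Avoiding (L (w' i k3)) (L (w' i k2))
    outside i = avoiding-< (unique (w' i k3))
                           (subst₂ _<_ (sym (halfLength (w' i k2))) (sym (halfLength (w' i k3))) ≤-refl)

    ψ₀ : V → ℕ
    ψ₀ (w' i k3) = colour (outside i)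
    ψ₀ _         = 0

    ψ₀-colouring : IsLColoringOn L S ψ₀
    ψ₀-colouring = terminal-pair-colouring tt tt (allowed (outside i1)) (allowed (outside i2))

    module Extend (φ : V → ℕ) (φ-colouring : IsLColoringOn L (S ∪ Pair v1 v3) φ)
                  (ψ₀≗φ : AgreeOn S ψ₀ φ) where

      α∈ : φ v1 ∈ L v1
      α∈ = proj₁ φ-colouring v1 (inj₂ (inj₁ refl))
      β∈ : φ v3 ∈ L v3
      β∈ = proj₁ φ-colouring v3 (inj₂ (inj₂ refl))

      c : I → ℕ
      c i = φ (w' i k3)

      c∈ : ∀ i → c i ∈ L (w' i k3)
      c∈ i1 = proj₁ φ-colouring _ (inj₁ (inj₁ refl))
      c∈ i2 = proj₁ φ-colouring _ (inj₁ (inj₂ refl))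

      c∉ : ∀ i → c i ∉ L (w' i k2)
      c∉ i1 = subst (_∉ L (w' i1 k2)) (ψ₀≗φ _ (inj₁ refl)) (avoids (outside i1))
      c∉ i2 = subst (_∉ L (w' i2 k2)) (ψ₀≗φ _ (inj₂ refl)) (avoids (outside i2))

      h : ℕ
      h = proj₁ (wheels α∈ β∈)
      W : WheelColouring (φ v1) (φ v3) h
      W = proj₂ (wheels α∈ β∈)

      y₂ : Avoiding (L y2) (h ∷ [])
      y₂ = pick y2 _
      y₃ : Avoiding (L y3) (colour y₂ ∷ [])
      y₃ = pick y3 _
      y₄ : Avoiding (L y4) (colour y₂ ∷ colour y₃ ∷ [])
      y₄ = pick y4 _
      z₁ : ∀ i → Avoiding (L (z i j1)) (colour y₄ ∷ [])
      z₁ i = pick (z i j1) _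
      z₂ : ∀ i → Avoiding (L (z i j2)) (colour y₄ ∷ [])
      z₂ i = pick (z i j2) _
      z₃ : ∀ i → Avoiding (L (z i j3)) (colour (z₁ i) ∷ colour (z₂ i) ∷ [])
      z₃ i = pick (z i j3) _
      z₄ : ∀ i → Avoiding (L (z i j4)) (colour (z₁ i) ∷ colour (z₂ i) ∷ colour (z₃ i) ∷ [])
      z₄ i = pick (z i j4) _
      z₅ : ∀ i → Avoiding (L (z i j5)) (colour (z₄ i) ∷ [])
      z₅ i = pick (z i j5) _
      z₆ : ∀ i → Avoiding (L (z i j6)) (colour (z₅ i) ∷ [])
      z₆ i = pick (z i j6) _
      z₇ : ∀ i → Avoiding (L (z i j7)) (colour (z₅ i) ∷ colour (z₆ i) ∷ [])
      z₇ i = pick (z i j7) _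
      w₁ : Avoiding (L w1) (colour (z₇ i1) ∷ colour (z₇ i2) ∷ [])
      w₁ = pick w1 _
      w₂ : Avoiding (L w2) (colour w₁ ∷ [])
      w₂ = pick w2 _
      w₃ : Avoiding (L w3) (colour w₁ ∷ colour w₂ ∷ [])
      w₃ = pick w3 _
      w′₁ : ∀ i → Avoiding (L (w' i k1)) (colour w₃ ∷ c i ∷ [])
      w′₁ i = pick (w' i k1) _
      w′₂ : ∀ i → Avoiding (L (w' i k2)) (colour (w′₁ i) ∷ [])
      w′₂ i = pick (w' i k2) _

      ρ : V → ℕ
      ρ y2 = colour y₂
      ρ y3 = colour y₃
      ρ y4 = colour y₄
      ρ (z i j1) = colour (z₁ i)
      ρ (z i j2) = colour (z₂ i)
      ρ (z i j3) = colour (z₃ i)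
      ρ (z i j4) = colour (z₄ i)
      ρ (z i j5) = colour (z₅ i)
      ρ (z i j6) = colour (z₆ i)
      ρ (z i j7) = colour (z₇ i)
      ρ w1 = colour w₁
      ρ w2 = colour w₂
      ρ w3 = colour w₃
      ρ (w' i k1) = colour (w′₁ i)
      ρ (w' i k2) = colour (w′₂ i)
      ρ (w' i k3) = c i
      ρ _ = 0

      φ′ : V → ℕ
      φ′ = withWheel W ρ

      φ′-allowed : ∀ v → φ′ v ∈ L v
      φ′-allowed v1 = α∈
      φ′-allowed u2 = allowed (WheelColouring.spoke W)
      φ′-allowed v3 = β∈
      φ′-allowed u4 = PathColouring.c₄∈ (WheelColouring.rest W)
      φ′-allowed u5 = PathColouring.c₅∈ (WheelColouring.rest W)
      φ′-allowed y1 = WheelColouring.y∈ W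
      φ′-allowed y2 = allowed y₂
      φ′-allowed y3 = allowed y₃
      φ′-allowed y4 = allowed y₄
      φ′-allowed (z i j1) = allowed (z₁ i)
      φ′-allowed (z i j2) = allowed (z₂ i)
      φ′-allowed (z i j3) = allowed (z₃ i)
      φ′-allowed (z i j4) = allowed (z₄ i)
      φ′-allowed (z i j5) = allowed (z₅ i)
      φ′-allowed (z i j6) = allowed (z₆ i)
      φ′-allowed (z i j7) = allowed (z₇ i)
      φ′-allowed w1 = allowed w₁
      φ′-allowed w2 = allowed w₂
      φ′-allowed w3 = allowed w₃
      φ′-allowed (w' i k1) = allowed (w′₁ i)
      φ′-allowed (w' i k2) = allowed (w′₂ i)
      φ′-allowed (w' i k3) = c∈ i

      edgesᵢ-proper : ∀ i → All (Proper φ′) (edgesᵢ i)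
      edgesᵢ-proper i =
        ≢-sym (∉⇒≢₀ (avoids (z₁ i))) ∷ ≢-sym (∉⇒≢₀ (avoids (z₂ i))) ∷
        ≢-sym (∉⇒≢₀ (avoids (z₃ i))) ∷ ≢-sym (∉⇒≢₀ (avoids (z₄ i))) ∷
        ≢-sym (∉⇒≢₁ (avoids (z₃ i))) ∷ ≢-sym (∉⇒≢₁ (avoids (z₄ i))) ∷ ≢-sym (∉⇒≢₂ (avoids (z₄ i))) ∷
        ≢-sym (∉⇒≢₀ (avoids (z₆ i))) ∷ ≢-sym (∉⇒≢₁ (avoids (z₇ i))) ∷ ≢-sym (∉⇒≢₀ (avoids (z₇ i))) ∷
        ≢-sym (∉⇒≢₀ (avoids (z₅ i))) ∷
        ≢-sym (∉⇒≢₀ (avoids (w′₂ i))) ∷ ∉⇒≢ (c∉ i) (allowed (w′₂ i)) ∘ sym ∷ ∉⇒≢₁ (avoids (w′₁ i)) ∷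
        ≢-sym (∉-pairᵢ {f = colour ∘ z₇} (avoids w₁) i) ∷ ≢-sym (∉⇒≢₀ (avoids (w′₁ i))) ∷ []

      φ′-proper : All (Proper φ′) edges
      φ′-proper = All-++⁺ {xs = wheel-edges} (withWheel-proper W ρ)
        ( ≢-sym (∉⇒≢₀ (avoids y₃)) ∷ ≢-sym (∉⇒≢₁ (avoids y₄)) ∷ ≢-sym (∉⇒≢₀ (avoids y₄)) ∷
          ≢-sym (∉⇒≢₀ (avoids y₂)) ∷
          ≢-sym (∉⇒≢₀ (avoids w₂)) ∷ ≢-sym (∉⇒≢₁ (avoids w₃)) ∷ ≢-sym (∉⇒≢₀ (avoids w₃)) ∷
          All-++⁺ (edgesᵢ-proper i1) (edgesᵢ-proper i2))

      φ≗φ′ : AgreeOn (S ∪ Pair v1 v3) φ φ′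
      φ≗φ′ _ (inj₁ (inj₁ refl)) = refl
      φ≗φ′ _ (inj₁ (inj₂ refl)) = refl
      φ≗φ′ _ (inj₂ (inj₁ refl)) = refl
      φ≗φ′ _ (inj₂ (inj₂ refl)) = refl

    extends : ExtendsAll L S (S ∪ Pair v1 v3) ψ₀
    extends φ φ-colouring ψ₀≗φ =
      φ′ , ((λ v _ → φ′-allowed v) , λ u v _ _ → proper-on-edges φ′-proper u v) , φ≗φ′
      where open Extend φ φ-colouring ψ₀≗φ

  relaxed : (∃ λ ψ₀ → IsLColoringOn L (Pair v1 v3) ψ₀ × ExtendsAll L (Pair v1 v3) (S ∪ Pair v1 v3) ψ₀)
          ⊎ ((∀ c → (c ∈ L v1) ⇔ (c ∈ L v3)) × (∃ λ ψ₀ → IsLColoringOn L S ψ₀ × ExtendsAll L S (S ∪ Pair v1 v3) ψ₀))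
  relaxed with outcome
  ... | flexible α∈ β∈ y≢y′ W W′ = inj₁ (ψ₀ , ψ₀-colouring , extends)
    where open PrecolouredEnds α∈ β∈ y≢y′ W W′
  ... | rigid L₁⇔L₃ wheels = inj₂ (L₁⇔L₃ , ψ₀ , ψ₀-colouring , extends)
    where open PrecolouredS wheels


edge : (e : Fin (length edges)) → Adj (proj₁ (lookup edges e)) (proj₂ (lookup edges e))
edge e = inj₁ (∈-lookup {xs = edges} e)

-- The first 17 edges of G₄ are those not indexed by i.
edgeᵢ : ∀ i (e : Fin 16) → Adj (proj₁ (lookup (edgesᵢ i) e)) (proj₂ (lookup (edgesᵢ i) e))
edgeᵢ i e = inj₁ (edgesᵢ⊆edges i (∈-lookup {xs = edgesᵢ i} e))
  where
  edgesᵢ⊆edges : ∀ i → edgesᵢ i ⊆ edges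
  edgesᵢ⊆edges i1 = ∈-++⁺ʳ (take 17 edges) ∘ ∈-++⁺ˡ
  edgesᵢ⊆edges i2 = ∈-++⁺ʳ (take 17 edges) ∘ ∈-++⁺ʳ (edgesᵢ i1)

R R₄ R₆ R₇₈ : List ℕ
R   = 1 ∷ 2 ∷ 3 ∷ 4 ∷ 7 ∷ 8 ∷ []
R₄  = 1 ∷ 2 ∷ 3 ∷ 4 ∷ []
R₆  = 1 ∷ 2 ∷ 3 ∷ 4 ∷ 5 ∷ 6 ∷ []
R₇₈ = 7 ∷ 8 ∷ []

Is78-of : ∀ {a b} → a ≢ b → a ∷ b ∷ [] ⊆ R₇₈ → Is78 (a , b)
Is78-of a≢b ab⊆ with ab⊆ (here refl) | ab⊆ (there (here refl))
... | here refl         | here refl         = ⊥-elim (a≢b refl)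
... | here refl         | there (here refl) = inj₁ (refl , refl)
... | there (here refl) | here refl         = inj₂ (refl , refl)
... | there (here refl) | there (here refl) = ⊥-elim (a≢b refl)

module TwoColouring (φ : V → ℕ × ℕ) (φ-colouring : Is2Coloring φ) where

  colours : V → List ℕ
  colours v = proj₁ (φ v) ∷ proj₂ (φ v) ∷ []

  colours-unique : ∀ v → Unique (colours v)
  colours-unique v = pair-unique (proj₁ φ-colouring v)

  colours⊆L4 : ∀ v → colours v ⊆ L4 v
  colours⊆L4 v (here refl)         = proj₁ (proj₁ (proj₂ φ-colouring) v)
  colours⊆L4 v (there (here refl)) = proj₂ (proj₁ (proj₂ φ-colouring) v)

  Apart : V → V → Set
  Apart u v = Disjoint (colours u) (colours v)

  apart : ∀ {u v} → Adj u v → Apart u v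
  apart {u} {v} adj (c∈u , c∈v) = proj₂ (proj₂ φ-colouring) u v adj _ (as-sum c∈u) (as-sum c∈v)
    where
    as-sum : ∀ {c w} → c ∈ colours w → c ≡ proj₁ (φ w) ⊎ c ≡ proj₂ (φ w)
    as-sum (here c≡)         = inj₁ c≡
    as-sum (there (here c≡)) = inj₂ c≡

  Apart-sym : ∀ {u v} → Apart u v → Apart v u
  Apart-sym u#v (c∈v , c∈u) = u#v (c∈u , c∈v)

  exhaust₂ : ∀ {a b} {A : List ℕ} → Apart a b → colours a ⊆ A → colours b ⊆ A → length A ≡ 4 →
             A ⊆ colours a ++ colours b
  exhaust₂ {a} {b} a#b a⊆ b⊆ ∣A∣ =
    Unique∧⊆∧length≡⇒⊇ (Unique-++⁺ (colours-unique a) (colours-unique b) a#b)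
                       ([ a⊆ , b⊆ ]′ ∘ ∈-++⁻ (colours a)) ∣A∣

  exhaust₃ : ∀ {a b c} {A : List ℕ} → Apart a b → Apart a c → Apart b c →
             colours a ⊆ A → colours b ⊆ A → colours c ⊆ A → length A ≡ 6 →
             A ⊆ colours a ++ colours b ++ colours c
  exhaust₃ {a} {b} {c} a#b a#c b#c a⊆ b⊆ c⊆ ∣A∣ =
    Unique∧⊆∧length≡⇒⊇
      (Unique-++⁺ (colours-unique a) (Unique-++⁺ (colours-unique b) (colours-unique c) b#c) (Disjoint-++ a#b a#c))
      ([ a⊆ , [ b⊆ , c⊆ ]′ ∘ ∈-++⁻ (colours b) ]′ ∘ ∈-++⁻ (colours a)) ∣A∣

  -- p loses 7 and 8 to x, so p and q use up R₄ and r is left with 7 and 8.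
  triangle-after-78 : ∀ {x p q r} → colours x ⊆ R₇₈ → Apart x p →
                      Apart p q → Apart p r → Apart q r →
                      colours p ⊆ R → colours q ⊆ R₄ → colours r ⊆ R → colours r ⊆ R₇₈
  triangle-after-78 {x} {p} x⊆ x#p p#q p#r q#r p⊆R q⊆R₄ r⊆R {c} c∈r with c ∈? R₄
  ... | no c∉R₄ = ∈-∖⁺ (r⊆R c∈r) c∉R₄
  ... | yes c∈R₄ with ∈-++⁻ (colours p) (exhaust₂ p#q p⊆R₄ q⊆R₄ refl c∈R₄)
    where
    R₇₈⊆x : R₇₈ ⊆ colours x
    R₇₈⊆x = Unique∧⊆∧length≡⇒⊇ (colours-unique x) x⊆ refl
    p⊆R₄ : colours p ⊆ R₄
    p⊆R₄ {d} d∈p with d ∈? R₇₈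
    ... | yes d∈R₇₈ = ⊥-elim (x#p (R₇₈⊆x d∈R₇₈ , d∈p))
    ... | no d∉R₇₈  = ∈-∖⁺ (p⊆R d∈p) d∉R₇₈
  ...   | inj₁ c∈p = ⊥-elim (p#r (c∈p , c∈r))
  ...   | inj₂ c∈q = ⊥-elim (q#r (c∈q , c∈r))

  -- Otherwise v₁, u₂, y₁ use up {1,…,6}; then v₃ repeats v₁ while u₄ and u₅ both repeat u₂.
  hub-meets-78 : ∃ λ c → c ∈ colours y1 × c ∈ R₇₈
  hub-meets-78 with exists-or-forall (λ c → toSum (c ∈? R₇₈)) (colours y1)
  ... | inj₁ c = c
  ... | inj₂ y1∌78 = ⊥-elim (apart (edge (# 3)) (∈u₄ , u2⊆u5 (u4⊆u2 ∈u₄)))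
    where
    y1⊆R₆ : colours y1 ⊆ R₆
    y1⊆R₆ c∈ = ∈-∖⁺ (colours⊆L4 y1 c∈) (y1∌78 c∈)
    R₆⊆ : R₆ ⊆ colours v1 ++ colours u2 ++ colours y1
    R₆⊆ = exhaust₃ (apart (edge (# 0))) (Apart-sym (apart (edge (# 5)))) (Apart-sym (apart (edge (# 6))))
                   (colours⊆L4 v1) (colours⊆L4 u2) y1⊆R₆ refl
    off-hub : ∀ {w} → Apart y1 w → colours w ⊆ R₆ → colours w ⊆ colours v1 ++ colours u2
    off-hub {w} y1#w w⊆R₆ c∈w with ∈-++⁻ (colours v1 ++ colours u2) (R₆⊆ (w⊆R₆ c∈w))
    ... | inj₁ c∈v1u2 = c∈v1u2
    ... | inj₂ c∈y1   = ⊥-elim (y1#w (c∈y1 , c∈w))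
    v3⊆v1 : colours v3 ⊆ colours v1
    v3⊆v1 = ⊆-++-Disjointʳ (off-hub (apart (edge (# 7))) (colours⊆L4 v3)) (Apart-sym (apart (edge (# 1))))
    v1⊆v3 : colours v1 ⊆ colours v3
    v1⊆v3 = Unique∧⊆∧length≡⇒⊇ (colours-unique v3) v3⊆v1 refl
    u4⊆u2 : colours u4 ⊆ colours u2
    u4⊆u2 = ⊆-++-Disjointˡ (off-hub (apart (edge (# 8))) (colours⊆L4 u4))
                           (λ (c∈u4 , c∈v1) → apart (edge (# 2)) (v1⊆v3 c∈v1 , c∈u4))
    u5⊆u2 : colours u5 ⊆ colours u2
    u5⊆u2 = ⊆-++-Disjointˡ (off-hub (apart (edge (# 9))) (colours⊆L4 u5)) (apart (edge (# 4)))
    u2⊆u5 : colours u2 ⊆ colours u5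
    u2⊆u5 = Unique∧⊆∧length≡⇒⊇ (colours-unique u5) u5⊆u2 refl
    ∈u₄ : proj₁ (φ u4) ∈ colours u4
    ∈u₄ = here refl

  y4-meets-78 : ∃ λ i → sixPlus i ∈ colours y4
  y4-meets-78 = let c , c∈y1 , c∈R₇₈ = hub-meets-78 in as-sixPlus c∈R₇₈ (c∈y4 c∈y1 c∈R₇₈)
    where
    R⊆ : R ⊆ colours y2 ++ colours y3 ++ colours y4
    R⊆ = exhaust₃ (apart (edge (# 10))) (apart (edge (# 12))) (apart (edge (# 11)))
                  (colours⊆L4 y2) (from-yes (R₄ ⊆? R) ∘ colours⊆L4 y3) (colours⊆L4 y4) refl
    c∈y4 : ∀ {c} → c ∈ colours y1 → c ∈ R₇₈ → c ∈ colours y4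
    c∈y4 c∈y1 c∈R₇₈ with ∈-++⁻ (colours y2 ++ colours y3) (R⊆ (from-yes (R₇₈ ⊆? R) c∈R₇₈))
    ... | inj₂ c∈y4 = c∈y4
    ... | inj₁ c∈y2y3 with ∈-++⁻ (colours y2) c∈y2y3
    ...   | inj₁ c∈y2 = ⊥-elim (apart (edge (# 13)) (c∈y1 , c∈y2))
    ...   | inj₂ c∈y3 = ⊥-elim (from-yes (Disjoint? R₇₈ R₄) (c∈R₇₈ , colours⊆L4 y3 c∈y3))
    as-sixPlus : ∀ {c} → c ∈ R₇₈ → c ∈ colours y4 → ∃ λ i → sixPlus i ∈ colours y4
    as-sixPlus (here refl)         c∈y4 = i1 , c∈y4
    as-sixPlus (there (here refl)) c∈y4 = i2 , c∈y4

  -- z_{i,1} and z_{i,2} lose 6+i to y₄, leaving the disjoint lists {1,2,3} and {4,5,6}, so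
  -- z_{i,1}, z_{i,2}, z_{i,3} use up {1,…,6} and z_{i,4} is coloured {7,8}.
  z₇-is-78 : ∀ i → sixPlus i ∈ colours y4 → colours (z i j7) ⊆ R₇₈
  z₇-is-78 i 6+i∈y4 =
    triangle-after-78 z₄⊆R₇₈ (apart (edgeᵢ i (# 10)))
                      (apart (edgeᵢ i (# 7))) (apart (edgeᵢ i (# 9))) (apart (edgeᵢ i (# 8)))
                      (colours⊆L4 _) (colours⊆L4 _) (colours⊆L4 _)
    where
    without-6+i : ∀ {w} A → Apart y4 w → colours w ⊆ A ++ sixPlus i ∷ [] → colours w ⊆ A
    without-6+i A y4#w w⊆ c∈w with ∈-snoc⁻ {xs = A} (w⊆ c∈w)
    ... | inj₁ c∈A  = c∈A
    ... | inj₂ refl = ⊥-elim (y4#w (6+i∈y4 , c∈w))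
    z1⊆123 : colours (z i j1) ⊆ 1 ∷ 2 ∷ 3 ∷ []
    z1⊆123 = without-6+i _ (apart (edgeᵢ i (# 0))) (colours⊆L4 (z i j1))
    z2⊆456 : colours (z i j2) ⊆ 4 ∷ 5 ∷ 6 ∷ []
    z2⊆456 = without-6+i _ (apart (edgeᵢ i (# 1))) (colours⊆L4 (z i j2))
    z1#z2 : Apart (z i j1) (z i j2)
    z1#z2 (c∈z1 , c∈z2) = from-yes (Disjoint? (1 ∷ 2 ∷ 3 ∷ []) (4 ∷ 5 ∷ 6 ∷ [])) (z1⊆123 c∈z1 , z2⊆456 c∈z2)
    R₆⊆ : R₆ ⊆ colours (z i j1) ++ colours (z i j2) ++ colours (z i j3)
    R₆⊆ = exhaust₃ z1#z2 (apart (edgeᵢ i (# 2))) (apart (edgeᵢ i (# 4)))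
                   (from-yes ((1 ∷ 2 ∷ 3 ∷ []) ⊆? R₆) ∘ z1⊆123) (from-yes ((4 ∷ 5 ∷ 6 ∷ []) ⊆? R₆) ∘ z2⊆456) (colours⊆L4 (z i j3)) refl
    z₄⊆R₇₈ : colours (z i j4) ⊆ R₇₈
    z₄⊆R₇₈ {c} c∈z4 with c ∈? R₆
    ... | no c∉R₆  = ∈-∖⁺ (colours⊆L4 (z i j4) c∈z4) c∉R₆
    ... | yes c∈R₆ = ⊥-elim (Disjoint-++ (Apart-sym (apart (edgeᵢ i (# 3))))
                               (Disjoint-++ (Apart-sym (apart (edgeᵢ i (# 5)))) (Apart-sym (apart (edgeᵢ i (# 6)))))
                               (c∈z4 , R₆⊆ c∈R₆))

  w3-is-78 : colours w3 ⊆ R₇₈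
  w3-is-78 = let i , 6+i∈y4 = y4-meets-78 in
    triangle-after-78 (z₇-is-78 i 6+i∈y4) (apart (edgeᵢ i (# 14)))
                      (apart (edge (# 14))) (apart (edge (# 16))) (apart (edge (# 15)))
                      (colours⊆L4 w1) (colours⊆L4 w2) (colours⊆L4 w3)

  w′₃-is-78 : ∀ i → Is78 (φ (w' i k3))
  w′₃-is-78 i = Is78-of (proj₁ φ-colouring (w' i k3)) (
    triangle-after-78 w3-is-78 (apart (edgeᵢ i (# 15)))
                      (apart (edgeᵢ i (# 11))) (apart (edgeᵢ i (# 13))) (apart (edgeᵢ i (# 12)))
                      (colours⊆L4 _) (colours⊆L4 _) (colours⊆L4 _))

lemma7 : Relaxed v1 v3 (Pair (w' i1 k3) (w' i2 k3))
       × ((φ : V → ℕ × ℕ) → Is2Coloring φ → Is78 (φ (w' i1 k3)) × Is78 (φ (w' i2 k3)))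
lemma7 = HalfListAssignment.relaxed , forced
  where
  forced : (φ : V → ℕ × ℕ) → Is2Coloring φ → Is78 (φ (w' i1 k3)) × Is78 (φ (w' i2 k3))
  forced φ φ-colouring = w′₃-is-78 i1 , w′₃-is-78 i2
    where open TwoColouring φ φ-colouring
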